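{- Let $p,q$ be integers with $p^2\neq 4q$, let $w_0,w_1$ be given initial values, and let $(w_n)$ be the Horadam sequence $w_n=pw_{n-1}-qw_{n-2}$ for $n\ge 2$. Let $\alpha,\beta$ be the two (distinct, possibly complex) roots of $x^2-px+q=0$, and put $$A=\frac{w_1-w_0\beta}{\alpha-\beta},\qquad B=\frac{w_0\alpha-w_1}{\alpha-\beta}.$$ Define $\alpha^*=1+\mathbf{i}\alpha+\boldsymbol{\varepsilon}\alpha^2+\mathbf{h}\alpha^3$, $\beta^*=1+\mathbf{i}\beta+\boldsymbol{\varepsilon}\beta^2+\mathbf{h}\beta^3$, $\underline{\alpha}=1+i\alpha+j\alpha^2+k\alpha^3$, $\underline{\beta}=1+i\beta+j\beta^2+k\beta^3$. Then for every $n\in\mathbb{N}$ the $n$th Horadam hybrid quaternion satisfies $$\widehat{H}_n=A\,\alpha^*\underline{\alpha}\,\alpha^n+B\,\beta^*\underline{\beta}\,\beta^n .$$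
   Context: Hybrid numbers: the real algebra $\mathbb{K}=\{a+b\mathbf{i}+c\boldsymbol{\varepsilon}+d\mathbf{h}: a,b,c,d\in\mathbb{R}\}$ with associative multiplication determined by $\mathbf{i}^2=-1$, $\boldsymbol{\varepsilon}^2=0$, $\mathbf{h}^2=1$, $\mathbf{i}\mathbf{h}=-\mathbf{h}\mathbf{i}=\boldsymbol{\varepsilon}+\mathbf{i}$; the full table is $\mathbf{i}\boldsymbol{\varepsilon}=1-\mathbf{h}$, $\boldsymbol{\varepsilon}\mathbf{i}=1+\mathbf{h}$, $\mathbf{i}\mathbf{h}=\boldsymbol{\varepsilon}+\mathbf{i}$, $\mathbf{h}\mathbf{i}=-\boldsymbol{\varepsilon}-\mathbf{i}$, $\boldsymbol{\varepsilon}\mathbf{h}=-\boldsymbol{\varepsilon}$, $\mathbf{h}\boldsymbol{\varepsilon}=\boldsymbol{\varepsilon}$. Hybrid quaternions: elements $z_0+z_1i+z_2j+z_3k$ with $z_0,\dots,z_3\in\mathbb{K}$, where $i,j,k$ are the real quaternion units ($i^2=j^2=k^2=ijk=-1$) and each quaternion unit commutes with each hybrid unit (i.e. the algebra $\mathbb{H}\otimes_{\mathbb{R}}\mathbb{K}$). When $\alpha,\beta$ are non-real, the identity is understood after extending scalars to $\mathbb{C}$ (complex scalars commuting with all units). The $n$th Horadam hybrid number is $\breve{H}_n=w_n+\mathbf{i}w_{n+1}+\boldsymbol{\varepsilon}w_{n+2}+\mathbf{h}w_{n+3}$, and the $n$th Horadam hybrid quaternion is $\widehat{H}_n=\breve{H}_n+i\breve{H}_{n+1}+j\breve{H}_{n+2}+k\breve{H}_{n+3}$.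 -}

module Defs where

open import Level using (_⊔_)
open import Algebra.Bundles using (CommutativeRing)
open import Data.Nat using (ℕ; zero; suc)
open import Data.Integer using (ℤ; +_; -[1+_])
open import Data.Product using (_×_)

-- Everything is developed over an arbitrary commutative (scalar) ring R,
-- which plays the role of ℂ (or ℝ) in the paper.
module HQ {c ℓ} (R : CommutativeRing c ℓ) where
  open CommutativeRing R

  fromℕ : ℕ → Carrier
  fromℕ zero = 0#
  fromℕ (suc n) = 1# + fromℕ n

  fromℤ : ℤ → Carrier
  fromℤ (+ n) = fromℕ n
  fromℤ -[1+ n ] = - fromℕ (suc n)

  pow : Carrier → ℕ → Carrier
  pow x zero = 1#
  pow x (suc n) = x * pow x n

  record Hyb : Set c where
    constructor mkH
    field re ii ee hh : Carrier
  open Hyb public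

  _≈H_ : Hyb → Hyb → Set ℓ
  x ≈H y = (re x ≈ re y) × (ii x ≈ ii y) × (ee x ≈ ee y) × (hh x ≈ hh y)

  _+H_ : Hyb → Hyb → Hyb
  x +H y = mkH (re x + re y) (ii x + ii y) (ee x + ee y) (hh x + hh y)

  -H_ : Hyb → Hyb
  -H x = mkH (- re x) (- ii x) (- ee x) (- hh x)

  _-H_ : Hyb → Hyb → Hyb
  x -H y = x +H (-H y)

  -- multiplication from the table
  -- 𝐢²=-1, ε²=0, 𝐡²=1, 𝐢ε=1-𝐡, ε𝐢=1+𝐡, 𝐢𝐡=ε+𝐢, 𝐡𝐢=-ε-𝐢, ε𝐡=-ε, 𝐡ε=ε
  _*H_ : Hyb → Hyb → Hyb
  mkH a₁ b₁ c₁ d₁ *H mkH a₂ b₂ c₂ d₂ = mkH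
    (a₁ * a₂ - b₁ * b₂ + b₁ * c₂ + c₁ * b₂ + d₁ * d₂)
    (a₁ * b₂ + b₁ * a₂ + b₁ * d₂ - d₁ * b₂)
    (a₁ * c₂ + c₁ * a₂ + b₁ * d₂ - c₁ * d₂ + d₁ * c₂ - d₁ * b₂)
    (a₁ * d₂ + d₁ * a₂ - b₁ * c₂ + c₁ * b₂)

  scH : Carrier → Hyb
  scH r = mkH r 0# 0# 0#

  -- Hybrid quaternions  z₀ + z₁ i + z₂ j + z₃ k,  zₐ ∈ 𝕂  (ℍ ⊗ 𝕂)
  record HQuat : Set c where
    constructor mkQ
    field q0 qi qj qk : Hyb
  open HQuat public

  _≈Q_ : HQuat → HQuat → Set ℓ
  x ≈Q y = (q0 x ≈H q0 y) × (qi x ≈H qi y) × (qj x ≈H qj y) × (qk x ≈H qk y)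

  _+Q_ : HQuat → HQuat → HQuat
  x +Q y = mkQ (q0 x +H q0 y) (qi x +H qi y) (qj x +H qj y) (qk x +H qk y)

  -- quaternion units commute with hybrid units; hybrid coefficients keep
  -- their left/right order.
  _*Q_ : HQuat → HQuat → HQuat
  mkQ z₀ z₁ z₂ z₃ *Q mkQ y₀ y₁ y₂ y₃ = mkQ
    ((((z₀ *H y₀) -H (z₁ *H y₁)) -H (z₂ *H y₂)) -H (z₃ *H y₃))
    ((((z₀ *H y₁) +H (z₁ *H y₀)) +H (z₂ *H y₃)) -H (z₃ *H y₂))
    ((((z₀ *H y₂) -H (z₁ *H y₃)) +H (z₂ *H y₀)) +H (z₃ *H y₁))
    ((((z₀ *H y₃) +H (z₁ *H y₂)) -H (z₂ *H y₁)) +H (z₃ *H y₀))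

  hybQ : Hyb → HQuat
  hybQ z = mkQ z (scH 0#) (scH 0#) (scH 0#)

  scQ : Carrier → HQuat
  scQ r = hybQ (scH r)

  horadam : ℤ → ℤ → Carrier → Carrier → ℕ → Carrier
  horadam p q w₀ w₁ zero = w₀
  horadam p q w₀ w₁ (suc zero) = w₁
  horadam p q w₀ w₁ (suc (suc n)) =
    fromℤ p * horadam p q w₀ w₁ (suc n) - fromℤ q * horadam p q w₀ w₁ n

  horadamHybrid : ℤ → ℤ → Carrier → Carrier → ℕ → Hyb
  horadamHybrid p q w₀ w₁ n = mkH (w n) (w (suc n)) (w (suc (suc n))) (w (suc (suc (suc n))))
    where w = horadam p q w₀ w₁

  horadamHQ : ℤ → ℤ → Carrier → Carrier → ℕ → HQuat
  horadamHQ p q w₀ w₁ n = mkQ (H n) (H (suc n)) (H (suc (suc n))) (H (suc (suc (suc n))))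
    where H = horadamHybrid p q w₀ w₁

  hybStar : Carrier → HQuat
  hybStar x = hybQ (mkH 1# x (pow x 2) (pow x 3))

  quatUnder : Carrier → HQuat
  quatUnder x = mkQ (scH 1#) (scH x) (scH (pow x 2)) (scH (pow x 3))

{-# OPTIONS --safe #-}
module Submission where

-- Binet's formula wₙ = Aαⁿ + Bβⁿ holds because both sides satisfy the recurrence
-- and agree at n = 0, 1. The coefficient of Ĥₙ at the quaternion unit of index i
-- and the hybrid unit of index j is w_{n+i+j}, so Ĥₙ depends linearly on the
-- shifted sequence (w_{n+k})ₖ, and it remains to treat a geometric sequence
-- a xᵏ m. There x* and x̲ lie in the commuting factors 𝕂 and ℍ of ℍ ⊗ 𝕂, so the
-- coefficient of x* x̲ at (i, j) is xⁱ xʲ and a x* x̲ m has coefficients a x^{i+j} m.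

open import Defs
open import Level using (_⊔_)
open import Algebra.Bundles using (CommutativeRing; RawRing)
open import Algebra.Construct.Pointwise as Pointwise using ()
open import Algebra.Morphism.Structures using (IsRingMonomorphism)
open import Algebra.Morphism.RingMonomorphism as RingMonomorphism using ()
open import Algebra.Solver.Ring.AlmostCommutativeRing
  using (fromCommutativeRing; _-Raw-AlmostCommutative⟶_)
open import Data.Bool using (T)
open import Data.Empty using (⊥-elim)
open import Data.Fin using (#_)
open import Data.Integer using (ℤ; _*_; +_)
open import Data.Maybe using (Maybe; just; nothing; is-just)
open import Data.Nat as ℕ using (ℕ; zero; suc)
open import Data.Nat.GeneralisedArithmetic using (fold)
open import Data.Product using (_,_)
open import Data.Vec using ([]; _∷_)
open import Relation.Binary.PropositionalEquality using (_≡_; _≢_)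
import Relation.Binary.Reasoning.Setoid as SetoidReasoning

-- Algebra.Solver.Ring decides identities by comparing normal forms definitionally,
-- which needs a coefficient ring computing with 0 and ±1; any other coefficient is
-- kept as an opaque element of R.
module SignedCoefficients {c ℓ} (R : CommutativeRing c ℓ) where
  open CommutativeRing R renaming (_*_ to _·_)
  open import Algebra.Properties.Ring ring using (-0#≈0#; -‿involutive; -1*x≈-x)

  data Coefficient : Set c where
    𝟘 𝟙 -𝟙 : Coefficient
    ⟨_⟩ : Carrier → Coefficient

  ⟦_⟧ᶜ : Coefficient → Carrier
  ⟦ 𝟘 ⟧ᶜ = 0#
  ⟦ 𝟙 ⟧ᶜ = 1#
  ⟦ -𝟙 ⟧ᶜ = - 1#
  ⟦ ⟨ r ⟩ ⟧ᶜ = r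

  _+ᶜ_ : Coefficient → Coefficient → Coefficient
  𝟘 +ᶜ y = y
  𝟙 +ᶜ 𝟘 = 𝟙
  -𝟙 +ᶜ 𝟘 = -𝟙
  ⟨ r ⟩ +ᶜ 𝟘 = ⟨ r ⟩
  𝟙 +ᶜ -𝟙 = 𝟘
  -𝟙 +ᶜ 𝟙 = 𝟘
  𝟙 +ᶜ 𝟙 = ⟨ 1# + 1# ⟩
  𝟙 +ᶜ ⟨ r ⟩ = ⟨ 1# + r ⟩
  -𝟙 +ᶜ -𝟙 = ⟨ - 1# + - 1# ⟩
  -𝟙 +ᶜ ⟨ r ⟩ = ⟨ - 1# + r ⟩
  ⟨ r ⟩ +ᶜ 𝟙 = ⟨ r + 1# ⟩
  ⟨ r ⟩ +ᶜ -𝟙 = ⟨ r + - 1# ⟩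
  ⟨ r ⟩ +ᶜ ⟨ s ⟩ = ⟨ r + s ⟩

  _*ᶜ_ : Coefficient → Coefficient → Coefficient
  𝟘 *ᶜ y = 𝟘
  𝟙 *ᶜ y = y
  -𝟙 *ᶜ 𝟘 = 𝟘
  -𝟙 *ᶜ 𝟙 = -𝟙
  -𝟙 *ᶜ -𝟙 = 𝟙
  -𝟙 *ᶜ ⟨ r ⟩ = ⟨ - 1# · r ⟩
  ⟨ r ⟩ *ᶜ 𝟘 = 𝟘
  ⟨ r ⟩ *ᶜ 𝟙 = ⟨ r ⟩
  ⟨ r ⟩ *ᶜ -𝟙 = ⟨ r · - 1# ⟩
  ⟨ r ⟩ *ᶜ ⟨ s ⟩ = ⟨ r · s ⟩

  -ᶜ_ : Coefficient → Coefficient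
  -ᶜ 𝟘 = 𝟘
  -ᶜ 𝟙 = -𝟙
  -ᶜ -𝟙 = 𝟙
  -ᶜ ⟨ r ⟩ = ⟨ - r ⟩

  coefficientRing : RawRing c c
  coefficientRing = record
    { Carrier = Coefficient ; _≈_ = _≡_ ; _+_ = _+ᶜ_ ; _*_ = _*ᶜ_ ; -_ = -ᶜ_ ; 0# = 𝟘 ; 1# = 𝟙 }

  +ᶜ-homo : ∀ x y → ⟦ x +ᶜ y ⟧ᶜ ≈ ⟦ x ⟧ᶜ + ⟦ y ⟧ᶜ
  +ᶜ-homo 𝟘 y = sym (+-identityˡ _)
  +ᶜ-homo 𝟙 𝟘 = sym (+-identityʳ _)
  +ᶜ-homo -𝟙 𝟘 = sym (+-identityʳ _)
  +ᶜ-homo ⟨ r ⟩ 𝟘 = sym (+-identityʳ _)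
  +ᶜ-homo 𝟙 -𝟙 = sym (-‿inverseʳ 1#)
  +ᶜ-homo -𝟙 𝟙 = sym (-‿inverseˡ 1#)
  +ᶜ-homo 𝟙 𝟙 = refl
  +ᶜ-homo 𝟙 ⟨ r ⟩ = refl
  +ᶜ-homo -𝟙 -𝟙 = refl
  +ᶜ-homo -𝟙 ⟨ r ⟩ = refl
  +ᶜ-homo ⟨ r ⟩ 𝟙 = refl
  +ᶜ-homo ⟨ r ⟩ -𝟙 = refl
  +ᶜ-homo ⟨ r ⟩ ⟨ s ⟩ = refl

  *ᶜ-homo : ∀ x y → ⟦ x *ᶜ y ⟧ᶜ ≈ ⟦ x ⟧ᶜ · ⟦ y ⟧ᶜ
  *ᶜ-homo 𝟘 y = sym (zeroˡ _)
  *ᶜ-homo 𝟙 y = sym (*-identityˡ _)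
  *ᶜ-homo -𝟙 𝟘 = sym (zeroʳ _)
  *ᶜ-homo -𝟙 𝟙 = sym (*-identityʳ _)
  *ᶜ-homo -𝟙 -𝟙 = sym (trans (-1*x≈-x (- 1#)) (-‿involutive 1#))
  *ᶜ-homo -𝟙 ⟨ r ⟩ = refl
  *ᶜ-homo ⟨ r ⟩ 𝟘 = sym (zeroʳ _)
  *ᶜ-homo ⟨ r ⟩ 𝟙 = sym (*-identityʳ _)
  *ᶜ-homo ⟨ r ⟩ -𝟙 = refl
  *ᶜ-homo ⟨ r ⟩ ⟨ s ⟩ = refl

  -ᶜ-homo : ∀ x → ⟦ -ᶜ x ⟧ᶜ ≈ - ⟦ x ⟧ᶜ
  -ᶜ-homo 𝟘 = sym -0#≈0#
  -ᶜ-homo 𝟙 = refl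
  -ᶜ-homo -𝟙 = sym (-‿involutive 1#)
  -ᶜ-homo ⟨ r ⟩ = refl

  ⟦⟧ᶜ-morphism : coefficientRing -Raw-AlmostCommutative⟶ fromCommutativeRing R
  ⟦⟧ᶜ-morphism = record
    { ⟦_⟧ = ⟦_⟧ᶜ ; +-homo = +ᶜ-homo ; *-homo = *ᶜ-homo ; -‿homo = -ᶜ-homo ; 0-homo = refl ; 1-homo = refl }

  _≟ᶜ_ : ∀ x y → Maybe (⟦ x ⟧ᶜ ≈ ⟦ y ⟧ᶜ)
  𝟘 ≟ᶜ 𝟘 = just refl
  𝟙 ≟ᶜ 𝟙 = just refl
  -𝟙 ≟ᶜ -𝟙 = just refl
  _ ≟ᶜ _ = nothing

module Expressions {c ℓ} (R : CommutativeRing c ℓ) where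
  open CommutativeRing R using (_≈_; refl; sym; trans)
  open SignedCoefficients R
  open import Algebra.Solver.Ring coefficientRing (fromCommutativeRing R) ⟦⟧ᶜ-morphism _≟ᶜ_ public
    using (Polynomial; Env; ⟦_⟧; var; con; _:+_; _:*_; :-_; _:-_; solve; _:=_)
  open import Algebra.Solver.Ring coefficientRing (fromCommutativeRing R) ⟦⟧ᶜ-morphism _≟ᶜ_
    using (normalise; _≟N_; ⟦_⟧N-cong; correct)

  functionRing : ℕ → CommutativeRing c (c ⊔ ℓ)
  functionRing n = Pointwise.commutativeRing (Env n) R

  record _≈ᴱ_ {n} (p q : Polynomial n) : Set (c ⊔ ℓ) where
    constructor semantically
    field evaluate : ∀ ρ → ⟦ p ⟧ ρ ≈ ⟦ q ⟧ ρ
  open _≈ᴱ_ public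

  -- The implicit argument computes to ⊤, and is filled in silently, exactly when the
  -- normal forms of p and q are recognised as equal.
  normalised : ∀ {n} {p q : Polynomial n} {agree : T (is-just (normalise p ≟N normalise q))} → p ≈ᴱ q
  normalised {p = p} {q} {agree} with normalise p ≟N normalise q
  ... | nothing = ⊥-elim agree
  ... | just eq = semantically (λ ρ → trans (sym (correct p ρ)) (trans (⟦ eq ⟧N-cong ρ) (correct q ρ)))

  expressionRawRing : ℕ → RawRing c (c ⊔ ℓ)
  expressionRawRing n = record
    { Carrier = Polynomial n
    ; _≈_ = _≈ᴱ_
    ; _+_ = _:+_ ; _*_ = _:*_ ; -_ = :-_ ; 0# = con 𝟘 ; 1# = con 𝟙
    }

  ⟦⟧-isRingMonomorphism : ∀ n →
    IsRingMonomorphism (expressionRawRing n) (CommutativeRing.rawRing (functionRing n)) ⟦_⟧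
  ⟦⟧-isRingMonomorphism n = record
    { isRingHomomorphism = record
      { isSemiringHomomorphism = record
        { isNearSemiringHomomorphism = record
          { +-isMonoidHomomorphism = record
            { isMagmaHomomorphism = record
              { isRelHomomorphism = record { cong = evaluate }
              ; homo = λ _ _ _ → refl
              }
            ; ε-homo = λ _ → refl
            }
          ; *-homo = λ _ _ _ → refl
          }
        ; 1#-homo = λ _ → refl
        }
      ; -‿homo = λ _ _ → refl
      }
    ; injective = semantically
    }

  -- The operations of Defs.HQ work over any commutative ring; at this ring of
  -- expressions they build the syntax of a hybrid-quaternion identity, whose
  -- evaluation is definitionally the same identity in R.
  expressionRing : ℕ → CommutativeRing c (c ⊔ ℓ)
  expressionRing n = record
    { isCommutativeRing = RingMonomorphism.isCommutativeRing (⟦⟧-isRingMonomorphism n)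
        (CommutativeRing.isCommutativeRing (functionRing n)) }

module HybridQuaternionProperties {c ℓ} (S : CommutativeRing c ℓ) where
  open CommutativeRing S using (trans; +-cong)
  open HQ S

  ≈H-trans : ∀ {x y z} → x ≈H y → y ≈H z → x ≈H z
  ≈H-trans (a , b , c , d) (a′ , b′ , c′ , d′) = trans a a′ , trans b b′ , trans c c′ , trans d d′

  ≈Q-trans : ∀ {x y z} → x ≈Q y → y ≈Q z → x ≈Q z
  ≈Q-trans (a , b , c , d) (a′ , b′ , c′ , d′) =
    ≈H-trans a a′ , ≈H-trans b b′ , ≈H-trans c c′ , ≈H-trans d d′

  +H-cong : ∀ {x x′ y y′} → x ≈H x′ → y ≈H y′ → (x +H y) ≈H (x′ +H y′)
  +H-cong (a , b , c , d) (a′ , b′ , c′ , d′) = +-cong a a′ , +-cong b b′ , +-cong c c′ , +-cong d d′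

  +Q-cong : ∀ {x x′ y y′} → x ≈Q x′ → y ≈Q y′ → (x +Q y) ≈Q (x′ +Q y′)
  +Q-cong (a , b , c , d) (a′ , b′ , c′ , d′) =
    +H-cong a a′ , +H-cong b b′ , +H-cong c c′ , +H-cong d d′

module HybridQuaternionSequences {c ℓ} (S : CommutativeRing c ℓ) where
  open CommutativeRing S renaming (_*_ to _·_)
  open HQ S

  -- horadamHQ p q w₀ w₁ n is definitionally fromSequence (λ k → horadam p q w₀ w₁ (k + n)).
  fromSequence : (ℕ → Carrier) → HQuat
  fromSequence f = mkQ (hybrid 0) (hybrid 1) (hybrid 2) (hybrid 3)
    where
    hybrid : ℕ → Hyb
    hybrid k = mkH (f k) (f (suc k)) (f (suc (suc k))) (f (suc (suc (suc k))))

  fromSequence-cong : ∀ {f g} → (∀ k → f k ≈ g k) → fromSequence f ≈Q fromSequence g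
  fromSequence-cong f≈g =
      (f≈g 0 , f≈g 1 , f≈g 2 , f≈g 3) , (f≈g 1 , f≈g 2 , f≈g 3 , f≈g 4)
    , (f≈g 2 , f≈g 3 , f≈g 4 , f≈g 5) , (f≈g 3 , f≈g 4 , f≈g 5 , f≈g 6)

  -- a xᵏ m, written as an iterated product so that for a numeral k and m = pow x n
  -- it unfolds to exactly a · pow x (k + n).
  geometric : Carrier → Carrier → Carrier → ℕ → Carrier
  geometric a x m k = a · fold m (x ·_) k

  binetTerm : Carrier → Carrier → Carrier → HQuat
  binetTerm a x m = ((scQ a *Q hybStar x) *Q quatUnder x) *Q scQ m

module Evaluation {c ℓ} (R : CommutativeRing c ℓ) where
  open Expressions R using (Env; ⟦_⟧; evaluate; expressionRing)
  open HQ R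
  private module E n = HQ (expressionRing n)

  evalH : ∀ {n} → Env n → E.Hyb n → Hyb
  evalH ρ (E.mkH a b c d) = mkH (⟦ a ⟧ ρ) (⟦ b ⟧ ρ) (⟦ c ⟧ ρ) (⟦ d ⟧ ρ)

  evalQ : ∀ {n} → Env n → E.HQuat n → HQuat
  evalQ ρ (E.mkQ x y z w) = mkQ (evalH ρ x) (evalH ρ y) (evalH ρ z) (evalH ρ w)

  evalH-cong : ∀ {n} {x y : E.Hyb n} → E._≈H_ n x y → ∀ ρ → evalH ρ x ≈H evalH ρ y
  evalH-cong (a , b , c , d) ρ = evaluate a ρ , evaluate b ρ , evaluate c ρ , evaluate d ρ

  evalQ-cong : ∀ {n} {x y : E.HQuat n} → E._≈Q_ n x y → ∀ ρ → evalQ ρ x ≈Q evalQ ρ y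
  evalQ-cong (x , y , z , w) ρ = evalH-cong x ρ , evalH-cong y ρ , evalH-cong z ρ , evalH-cong w ρ

module GeometricSequences {c ℓ} (R : CommutativeRing c ℓ) where
  open HQ R
  open HybridQuaternionSequences R
  open Expressions R using (var; expressionRing; normalised)
  open Evaluation R using (evalQ-cong)
  private
    module E = HybridQuaternionSequences (expressionRing 3)
    module EQ = HQ (expressionRing 3)

  fromSequence-geometric : ∀ a x m → fromSequence (geometric a x m) ≈Q binetTerm a x m
  fromSequence-geometric a x m = evalQ-cong symbolic (a ∷ x ∷ m ∷ [])
    where
    symbolic : E.fromSequence (E.geometric (var (# 0)) (var (# 1)) (var (# 2)))
               EQ.≈Q E.binetTerm (var (# 0)) (var (# 1)) (var (# 2))
    symbolic = (normalised , normalised , normalised , normalised)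
             , (normalised , normalised , normalised , normalised)
             , (normalised , normalised , normalised , normalised)
             , (normalised , normalised , normalised , normalised)

module HoradamRecurrence {c ℓ} (R : CommutativeRing c ℓ) where
  open CommutativeRing R renaming (_*_ to _·_)
  open HQ R using (fromℤ; pow; horadam)
  open SignedCoefficients R using (𝟙)
  open Expressions R using (con; _:+_; _:*_; _:-_; solve; _:=_)
  open SetoidReasoning setoid

  SatisfiesRecurrence : Carrier → Carrier → (ℕ → Carrier) → Set ℓ
  SatisfiesRecurrence P Q u = ∀ n → u (suc (suc n)) ≈ P · u (suc n) - Q · u n

  pow-satisfiesRecurrence : ∀ {P Q x} → pow x 2 - P · x + Q ≈ 0# → SatisfiesRecurrence P Q (pow x)
  pow-satisfiesRecurrence {P} {Q} {x} root n = begin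
    x · (x · xⁿ)                                       ≈⟨ rearrange P Q x xⁿ ⟩
    P · (x · xⁿ) - Q · xⁿ + (pow x 2 - P · x + Q) · xⁿ ≈⟨ +-congˡ (trans (*-congʳ root) (zeroˡ xⁿ)) ⟩
    P · (x · xⁿ) - Q · xⁿ + 0#                         ≈⟨ +-identityʳ _ ⟩
    P · (x · xⁿ) - Q · xⁿ                              ∎
    where
    xⁿ = pow x n
    rearrange : ∀ P Q x m → x · (x · m) ≈ P · (x · m) - Q · m + (pow x 2 - P · x + Q) · m
    rearrange = solve 4 (λ P Q x m →
      x :* (x :* m) := P :* (x :* m) :- Q :* m :+ (x :* (x :* con 𝟙) :- P :* x :+ Q) :* m) refl

  combination-satisfiesRecurrence : ∀ {P Q u v} →
    SatisfiesRecurrence P Q u → SatisfiesRecurrence P Q v →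
    ∀ a b → SatisfiesRecurrence P Q (λ n → a · u n + b · v n)
  combination-satisfiesRecurrence {P} {Q} {u} {v} u-rec v-rec a b n = begin
    a · u (suc (suc n)) + b · v (suc (suc n))
      ≈⟨ +-cong (*-congˡ (u-rec n)) (*-congˡ (v-rec n)) ⟩
    a · (P · u (suc n) - Q · u n) + b · (P · v (suc n) - Q · v n)
      ≈⟨ regroup P Q a b (u (suc n)) (u n) (v (suc n)) (v n) ⟩
    P · (a · u (suc n) + b · v (suc n)) - Q · (a · u n + b · v n) ∎
    where
    regroup : ∀ P Q a b u₁ u₀ v₁ v₀ →
      a · (P · u₁ - Q · u₀) + b · (P · v₁ - Q · v₀) ≈ P · (a · u₁ + b · v₁) - Q · (a · u₀ + b · v₀)
    regroup = solve 8 (λ P Q a b u₁ u₀ v₁ v₀ →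
      a :* (P :* u₁ :- Q :* u₀) :+ b :* (P :* v₁ :- Q :* v₀)
        := P :* (a :* u₁ :+ b :* v₁) :- Q :* (a :* u₀ :+ b :* v₀)) refl

  horadam-unique : ∀ {p q w₀ w₁ u} → SatisfiesRecurrence (fromℤ p) (fromℤ q) u →
    w₀ ≈ u 0 → w₁ ≈ u 1 → ∀ n → horadam p q w₀ w₁ n ≈ u n
  horadam-unique rec w₀≈ w₁≈ zero = w₀≈
  horadam-unique rec w₀≈ w₁≈ (suc zero) = w₁≈
  horadam-unique rec w₀≈ w₁≈ (suc (suc n)) =
    trans (+-cong (*-congˡ (horadam-unique rec w₀≈ w₁≈ (suc n)))
                  (-‿cong (*-congˡ (horadam-unique rec w₀≈ w₁≈ n))))
          (sym (rec n))

  binet : ∀ p q w₀ w₁ {α β d} →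
    pow α 2 - fromℤ p · α + fromℤ q ≈ 0# →
    pow β 2 - fromℤ p · β + fromℤ q ≈ 0# →
    (α - β) · d ≈ 1# →
    ∀ n → horadam p q w₀ w₁ n ≈ (w₁ - w₀ · β) · d · pow α n + (w₀ · α - w₁) · d · pow β n
  binet p q w₀ w₁ {α} {β} {d} α-root β-root αβd≈1 =
    horadam-unique
      (combination-satisfiesRecurrence (pow-satisfiesRecurrence α-root) (pow-satisfiesRecurrence β-root) A B)
      (begin
        w₀                     ≈⟨ scale w₀ ⟩
        w₀ · ((α - β) · d)     ≈⟨ initial₀ w₀ w₁ α β d ⟩
        A · 1# + B · 1#        ∎)
      (begin
        w₁                     ≈⟨ scale w₁ ⟩
        w₁ · ((α - β) · d)     ≈⟨ initial₁ w₀ w₁ α β d ⟩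
        A · (α · 1#) + B · (β · 1#) ∎)
    where
    A = (w₁ - w₀ · β) · d
    B = (w₀ · α - w₁) · d
    scale : ∀ w → w ≈ w · ((α - β) · d)
    scale w = sym (trans (*-congˡ αβd≈1) (*-identityʳ w))
    initial₀ : ∀ w₀ w₁ α β d →
      w₀ · ((α - β) · d) ≈ (w₁ - w₀ · β) · d · 1# + (w₀ · α - w₁) · d · 1#
    initial₀ = solve 5 (λ w₀ w₁ α β d →
      w₀ :* ((α :- β) :* d) := (w₁ :- w₀ :* β) :* d :* con 𝟙 :+ (w₀ :* α :- w₁) :* d :* con 𝟙) refl
    initial₁ : ∀ w₀ w₁ α β d →
      w₁ · ((α - β) · d) ≈ (w₁ - w₀ · β) · d · (α · 1#) + (w₀ · α - w₁) · d · (β · 1#)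
    initial₁ = solve 5 (λ w₀ w₁ α β d →
      w₁ :* ((α :- β) :* d)
        := (w₁ :- w₀ :* β) :* d :* (α :* con 𝟙) :+ (w₀ :* α :- w₁) :* d :* (β :* con 𝟙)) refl

mainTheorem1 : ∀ {c ℓ} (R : CommutativeRing c ℓ) → let open CommutativeRing R renaming (_*_ to _·_) in let open HQ R in
    (p q : ℤ) → p * p ≢ (+ 4) * q →
    (w₀ w₁ α β : Carrier) →
    pow α 2 - fromℤ p · α + fromℤ q ≈ 0# →
    pow β 2 - fromℤ p · β + fromℤ q ≈ 0# →
    (d : Carrier) → (α - β) · d ≈ 1# →
    let A = (w₁ - w₀ · β) · d
        B = (w₀ · α - w₁) · d
    in (n : ℕ) →
       horadamHQ p q w₀ w₁ n
         ≈Q ((((scQ A *Q hybStar α) *Q quatUnder α) *Q scQ (pow α n))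
             +Q (((scQ B *Q hybStar β) *Q quatUnder β) *Q scQ (pow β n)))
-- The discriminant condition only ensures α ≠ β; the proof uses the inverse d of α − β instead.
mainTheorem1 R p q _ w₀ w₁ α β α-root β-root d αβd≈1 n =
  ≈Q-trans (fromSequence-cong (λ k → binet p q w₀ w₁ α-root β-root αβd≈1 (k ℕ.+ n)))
           (+Q-cong (fromSequence-geometric A α (pow α n)) (fromSequence-geometric B β (pow β n)))
  where
  open CommutativeRing R renaming (_*_ to _·_)
  open HQ R
  open HybridQuaternionProperties R
  open HybridQuaternionSequences R
  open GeometricSequences R
  open HoradamRecurrence R
  A = (w₁ - w₀ · β) · d
  B = (w₀ · α - w₁) · d
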